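{- Let $Q_{2,1}=\mathrm{conv}\{(0,0),(a,b),(c,d)\}$ and $Q_{2,2}=\mathrm{conv}\{(0,0),(a',b'),(c',d')\}$ be integral $2$-simplices in $\mathbb{R}^2$, let $n>2$, and let $$Q_{n,1}=\mathrm{conv}\{\mathbf{0},(a,b,0,\dots,0),(c,d,0,\dots,0),\mathbf{e_3},\dots,\mathbf{e_n}\},\quad Q_{n,2}=\mathrm{conv}\{\mathbf{0},(a',b',0,\dots,0),(c',d',0,\dots,0),\mathbf{e_3},\dots,\mathbf{e_n}\}.$$ Let $U(\mathbf{v})=M\mathbf{v}+\mathbf{u}$ with $M\in\operatorname{GL}_n(\mathbb{Z})$, $\mathbf{u}\in\mathbb{Z}^n$ satisfy $U(Q_{n,1})=Q_{n,2}$. If $U(a,b,0,\dots,0)=\mathbf{e_i}$ for some $3\le i\le n$, then, with $k=\gcd(c,d)$, $$\begin{pmatrix}a&\frac{c}{k}\\ b&\frac{d}{k}\end{pmatrix}\in\operatorname{GL}_2(\mathbb{Z}).$$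
   Context: $a,b,c,d,a',b',c',d'\in\mathbb{Z}$ and $\mathbf{e_i}$ denotes the $i$-th standard basis vector of $\mathbb{R}^n$. -}

module Defs where

open import Data.Nat as ℕ using (ℕ; zero; suc)
open import Data.Fin using (Fin; zero; suc)
open import Data.Integer as ℤ using (ℤ; +_)
open import Data.Rational as ℚ using (ℚ; 0ℚ; 1ℚ)
open import Data.Product using (Σ; _×_)
open import Relation.Binary.PropositionalEquality using (_≡_)

sumℤ : ∀ {m} → (Fin m → ℤ) → ℤ
sumℤ {zero}  f = + 0
sumℤ {suc m} f = f zero ℤ.+ sumℤ (λ i → f (suc i))

sumℚ : ∀ {m} → (Fin m → ℚ) → ℚ
sumℚ {zero}  f = 0ℚ
sumℚ {suc m} f = f zero ℚ.+ sumℚ (λ i → f (suc i))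

Vecℤ : ℕ → Set
Vecℤ n = Fin n → ℤ

Matℤ : ℕ → Set
Matℤ n = Fin n → Fin n → ℤ

_·ₘ_ : ∀ {n} → Matℤ n → Matℤ n → Matℤ n
(A ·ₘ B) i j = sumℤ (λ k → A i k ℤ.* B k j)

δ : ∀ {n} → Fin n → Fin n → ℤ
δ zero    zero    = + 1
δ zero    (suc j) = + 0
δ (suc i) zero    = + 0
δ (suc i) (suc j) = δ i j

idMat : ∀ {n} → Matℤ n
idMat = δ

GL : (n : ℕ) → Matℤ n → Set
GL n M = Σ (Matℤ n) λ N → (∀ i j → (M ·ₘ N) i j ≡ idMat i j) × (∀ i j → (N ·ₘ M) i j ≡ idMat i j)

-- standard basis vector e_i (0-indexed: Fin index i corresponds to e_{i+1})
e : ∀ {n} → Fin n → Vecℤ n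
e i j = δ i j

emb2 : ∀ {n} → ℤ → ℤ → Vecℤ n
emb2 x y zero          = x
emb2 x y (suc zero)    = y
emb2 x y (suc (suc j)) = + 0

-- vertices of Q_n = conv{0, (a,b,0..), (c,d,0..), e_3, ..., e_n}
-- indexed by Fin (suc n): 0 ↦ 0, 1 ↦ (a,b,..), 2 ↦ (c,d,..), k+1 ↦ e_{k+1} for k ≥ 2
vertsQ : ∀ {n} → ℤ → ℤ → ℤ → ℤ → Fin (suc n) → Vecℤ n
vertsQ a b c d zero                   = λ _ → + 0
vertsQ a b c d (suc zero)             = emb2 a b
vertsQ a b c d (suc (suc zero))       = emb2 c d
vertsQ a b c d (suc (suc (suc j)))    = e (suc (suc j))

Vecℚ : ℕ → Set
Vecℚ n = Fin n → ℚ

toℚ : ℤ → ℚ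
toℚ z = z ℚ./ 1

InConv : ∀ {n m} → (Fin m → Vecℤ n) → Vecℚ n → Set
InConv {n} {m} v x =
  Σ (Fin m → ℚ) λ w →
    (∀ i → 0ℚ ℚ.≤ w i) × (sumℚ w ≡ 1ℚ) ×
    (∀ j → x j ≡ sumℚ (λ i → w i ℚ.* toℚ (v i j)))

affℚ : ∀ {n} → Matℤ n → Vecℤ n → Vecℚ n → Vecℚ n
affℚ M u x i = sumℚ (λ k → toℚ (M i k) ℚ.* x k) ℚ.+ toℚ (u i)

affℤ : ∀ {n} → Matℤ n → Vecℤ n → Vecℤ n → Vecℤ n
affℤ M u x i = sumℤ (λ k → M i k ℤ.* x k) ℤ.+ u i

-- U(P) = P' as sets (checked on rational points; P, P' are rational polytopes)
MapsOnto : ∀ {n m} → Matℤ n → Vecℤ n → (Fin m → Vecℤ n) → (Fin m → Vecℤ n) → Set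
MapsOnto {n} M u P P' =
  ∀ (y : Vecℚ n) → (InConv P' y → Σ (Vecℚ n) λ x → InConv P x × (∀ j → affℚ M u x j ≡ y j))
                 × (∀ x → InConv P x → (∀ j → affℚ M u x j ≡ y j) → InConv P' y)

mat2 : ℤ → ℤ → ℤ → ℤ → Matℤ 2
mat2 p q r s zero       zero       = p
mat2 p q r s zero       (suc zero) = q
mat2 p q r s (suc zero) zero       = r
mat2 p q r s (suc zero) (suc zero) = s

-- The i-th coordinate of an integral point of Q_{n,2} is its barycentric weight on the
-- vertex e_i, hence 0 or 1, and it is 1 only at e_i itself. Since U is injective and sends
-- (a,b,0,…,0) to e_i, neither U(0) nor U(c,d,0,…,0) is e_i, so both have i-th coordinate 0.
-- Row i of M then gives x, y with x a + y b = 1 and x c + y d = 0, whence d = x·det and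
-- c = -y·det for det = a d - b c. So det divides k = gcd(c,d), while det = k·det(a, c/k; b, d/k);
-- the last determinant is therefore ±1.
module Submission where

open import Defs
open import Data.Nat using (ℕ; _<_; _≤_)
open import Data.Fin using (Fin; toℕ)
open import Data.Integer using (ℤ; _*_; _-_; 0ℤ)
open import Data.Integer.GCD using (gcd)
open import Data.Product using (Σ; _×_)
open import Relation.Binary.PropositionalEquality using (_≡_; _≢_)

open import Data.Fin using (zero; suc)
import Data.Integer as ℤ
open import Data.Integer using (+_; -[1+_]; _+_; -_)
import Data.Integer.Properties as ℤP
import Data.Integer.Divisibility.Signed as ℤS
import Data.Integer.Divisibility as ℤU
import Data.Integer.GCD as ℤG
import Data.Nat.Divisibility as ℕD
import Data.Nat as ℕ
import Data.Nat.Coprimality as ℕC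
open import Data.Rational as ℚ using (ℚ; mkℚ; 0ℚ; 1ℚ; ↥_; ↧_)
import Data.Rational.Properties as ℚP
import Data.Rational.Unnormalised as ℚᵘ
import Data.Rational.Unnormalised.Properties as ℚᵘP
open import Data.Product using (_,_; proj₂)
open import Data.Sum using (_⊎_; inj₁; inj₂)
open import Data.Empty using (⊥-elim)
open import Data.Vec.Functional using (removeAt)
open import Relation.Binary.PropositionalEquality
  using (refl; sym; trans; cong; cong₂; subst; subst₂; module ≡-Reasoning)
open import Data.Integer.Tactic.RingSolver using (solve-∀)
import Algebra.Properties.Semiring.Sum as SemiringSum
open import Algebra.Bundles using (AbelianGroup; CommutativeRing)
import Algebra.Properties.Group as GroupProperties

module ℤΣ = SemiringSum ℤP.+-*-semiring
module ℚΣ = SemiringSum (CommutativeRing.semiring ℚP.+-*-commutativeRing)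
module ℤ+ = GroupProperties (AbelianGroup.group ℤP.+-0-abelianGroup)
module ℚ+ = GroupProperties ℚP.+-0-group

toℚ≡mkℚ : ∀ i → toℚ i ≡ mkℚ i 0 (ℕC.sym (ℕC.1-coprimeTo ℤ.∣ i ∣))
toℚ≡mkℚ i = ℚP.↥p/↧p≡p (mkℚ i 0 _)

↥-toℚ : ∀ i → ↥ toℚ i ≡ i
↥-toℚ i = cong ↥_ (toℚ≡mkℚ i)

↧-toℚ : ∀ i → ↧ toℚ i ≡ + 1
↧-toℚ i = cong ↧_ (toℚ≡mkℚ i)

toℚᵘ-toℚ : ∀ i → ℚ.toℚᵘ (toℚ i) ≡ ℚᵘ.mkℚᵘ i 0
toℚᵘ-toℚ i = cong ℚ.toℚᵘ (toℚ≡mkℚ i)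

toℚ-injective : ∀ {i j} → toℚ i ≡ toℚ j → i ≡ j
toℚ-injective {i} {j} eq = trans (sym (↥-toℚ i)) (trans (cong ↥_ eq) (↥-toℚ j))

toℚ-cancel-≤ : ∀ {i j} → toℚ i ℚ.≤ toℚ j → i ℤ.≤ j
toℚ-cancel-≤ {i} {j} le = subst₂ ℤ._≤_ (numerator i j) (numerator j i) (ℚP.drop-*≤* le)
  where
  numerator : ∀ k l → ↥ toℚ k * ↧ toℚ l ≡ k
  numerator k l = trans (cong₂ _*_ (↥-toℚ k) (↧-toℚ l)) (ℤP.*-identityʳ k)

0≤i≤1⇒i≡0⊎i≡1 : ∀ {i} → + 0 ℤ.≤ i → i ℤ.≤ + 1 → i ≡ + 0 ⊎ i ≡ + 1
0≤i≤1⇒i≡0⊎i≡1 {+ 0}                 _ _                  = inj₁ refl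
0≤i≤1⇒i≡0⊎i≡1 {+ 1}                 _ _                  = inj₂ refl
0≤i≤1⇒i≡0⊎i≡1 {+ ℕ.suc (ℕ.suc _)}   _ (ℤ.+≤+ (ℕ.s≤s ()))
0≤i≤1⇒i≡0⊎i≡1 { -[1+ _ ]}           () _

toℚ-+ : ∀ i j → toℚ (i + j) ≡ toℚ i ℚ.+ toℚ j
toℚ-+ i j = ℚP.toℚᵘ-injective (begin
  ℚ.toℚᵘ (toℚ (i + j))                 ≡⟨ toℚᵘ-toℚ (i + j) ⟩
  ℚᵘ.mkℚᵘ (i + j) 0                    ≈⟨ ℚᵘ.*≡* (cross i j) ⟩
  ℚᵘ.mkℚᵘ i 0 ℚᵘ.+ ℚᵘ.mkℚᵘ j 0         ≡⟨ sym (cong₂ ℚᵘ._+_ (toℚᵘ-toℚ i) (toℚᵘ-toℚ j)) ⟩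
  ℚ.toℚᵘ (toℚ i) ℚᵘ.+ ℚ.toℚᵘ (toℚ j)   ≈⟨ ℚᵘP.≃-sym (ℚP.toℚᵘ-homo-+ (toℚ i) (toℚ j)) ⟩
  ℚ.toℚᵘ (toℚ i ℚ.+ toℚ j)             ∎)
  where
  open ℚᵘP.≃-Reasoning
  cross : ∀ i j → (i + j) * + 1 ≡ (i * + 1 + j * + 1) * + 1
  cross = solve-∀

toℚ-* : ∀ i j → toℚ (i * j) ≡ toℚ i ℚ.* toℚ j
toℚ-* i j = ℚP.toℚᵘ-injective (begin
  ℚ.toℚᵘ (toℚ (i * j))                 ≡⟨ toℚᵘ-toℚ (i * j) ⟩
  ℚᵘ.mkℚᵘ (i * j) 0                    ≡⟨⟩
  ℚᵘ.mkℚᵘ i 0 ℚᵘ.* ℚᵘ.mkℚᵘ j 0         ≡⟨ sym (cong₂ ℚᵘ._*_ (toℚᵘ-toℚ i) (toℚᵘ-toℚ j)) ⟩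
  ℚ.toℚᵘ (toℚ i) ℚᵘ.* ℚ.toℚᵘ (toℚ j)   ≈⟨ ℚᵘP.≃-sym (ℚP.toℚᵘ-homo-* (toℚ i) (toℚ j)) ⟩
  ℚ.toℚᵘ (toℚ i ℚ.* toℚ j)             ∎)
  where open ℚᵘP.≃-Reasoning

sumℤ≡∑ : ∀ {m} (f : Fin m → ℤ) → sumℤ f ≡ ℤΣ.sum f
sumℤ≡∑ {ℕ.zero}  f = refl
sumℤ≡∑ {ℕ.suc m} f = cong (_+_ (f zero)) (sumℤ≡∑ (λ k → f (suc k)))

sumℚ≡∑ : ∀ {m} (f : Fin m → ℚ) → sumℚ f ≡ ℚΣ.sum f
sumℚ≡∑ {ℕ.zero}  f = refl
sumℚ≡∑ {ℕ.suc m} f = cong (f zero ℚ.+_) (sumℚ≡∑ (λ k → f (suc k)))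

sumℤ-cong : ∀ {m} {f g : Fin m → ℤ} → (∀ k → f k ≡ g k) → sumℤ f ≡ sumℤ g
sumℤ-cong {f = f} {g} f≗g = trans (sumℤ≡∑ f) (trans (ℤΣ.sum-cong-≗ f≗g) (sym (sumℤ≡∑ g)))

sumℤ-zero : ∀ {m} {f : Fin m → ℤ} → (∀ k → f k ≡ + 0) → sumℤ f ≡ + 0
sumℤ-zero {m} f≗0 = trans (sumℤ-cong f≗0) (trans (sumℤ≡∑ {m} (λ _ → + 0)) (ℤΣ.sum-replicate-zero m))

sumℤ-*ˡ : ∀ {m} x (f : Fin m → ℤ) → x * sumℤ f ≡ sumℤ (λ k → x * f k)
sumℤ-*ˡ x f = trans (cong (x *_) (sumℤ≡∑ f)) (trans (ℤΣ.*-distribˡ-sum x f) (sym (sumℤ≡∑ (λ k → x * f k))))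

sumℤ-*ʳ : ∀ {m} x (f : Fin m → ℤ) → sumℤ f * x ≡ sumℤ (λ k → f k * x)
sumℤ-*ʳ x f = trans (cong (_* x) (sumℤ≡∑ f)) (trans (ℤΣ.*-distribʳ-sum x f) (sym (sumℤ≡∑ (λ k → f k * x))))

sumℤ-comm : ∀ {m n} (f : Fin m → Fin n → ℤ) →
            sumℤ (λ k → sumℤ (λ l → f k l)) ≡ sumℤ (λ l → sumℤ (λ k → f k l))
sumℤ-comm f = begin
  sumℤ (λ k → sumℤ (f k))                    ≡⟨ sumℤ-cong (λ k → sumℤ≡∑ (f k)) ⟩
  sumℤ (λ k → ℤΣ.sum (f k))                  ≡⟨ sumℤ≡∑ (λ k → ℤΣ.sum (f k)) ⟩
  ℤΣ.sum (λ k → ℤΣ.sum (f k))                ≡⟨ ℤΣ.∑-comm f ⟩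
  ℤΣ.sum (λ l → ℤΣ.sum (λ k → f k l))        ≡⟨ sym (sumℤ≡∑ (λ l → ℤΣ.sum (λ k → f k l))) ⟩
  sumℤ (λ l → ℤΣ.sum (λ k → f k l))          ≡⟨ sumℤ-cong (λ l → sym (sumℤ≡∑ (λ k → f k l))) ⟩
  sumℤ (λ l → sumℤ (λ k → f k l))            ∎
  where open ≡-Reasoning

sumℚ-cong : ∀ {m} {f g : Fin m → ℚ} → (∀ k → f k ≡ g k) → sumℚ f ≡ sumℚ g
sumℚ-cong {f = f} {g} f≗g = trans (sumℚ≡∑ f) (trans (ℚΣ.sum-cong-≗ f≗g) (sym (sumℚ≡∑ g)))

sumℚ-zero : ∀ m → sumℚ {m} (λ _ → 0ℚ) ≡ 0ℚ
sumℚ-zero m = trans (sumℚ≡∑ {m} (λ _ → 0ℚ)) (ℚΣ.sum-replicate-zero m)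

toℚ-sum : ∀ {m} (f : Fin m → ℤ) → toℚ (sumℤ f) ≡ sumℚ (λ k → toℚ (f k))
toℚ-sum {ℕ.zero}  f = refl
toℚ-sum {ℕ.suc m} f = trans (toℚ-+ (f zero) _) (cong (toℚ (f zero) ℚ.+_) (toℚ-sum (λ k → f (suc k))))

sumℚ-remove : ∀ {m} (w : Fin (ℕ.suc m) → ℚ) i → sumℚ w ≡ w i ℚ.+ sumℚ (removeAt w i)
sumℚ-remove w i = begin
  sumℚ w                            ≡⟨ sumℚ≡∑ w ⟩
  ℚΣ.sum w                          ≡⟨ ℚΣ.sum-remove w ⟩
  w i ℚ.+ ℚΣ.sum (removeAt w i)     ≡⟨ cong (w i ℚ.+_) (sym (sumℚ≡∑ (removeAt w i))) ⟩
  w i ℚ.+ sumℚ (removeAt w i)       ∎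
  where open ≡-Reasoning

p≤p+q : ∀ p {q} → 0ℚ ℚ.≤ q → p ℚ.≤ p ℚ.+ q
p≤p+q p {q} q≥0 = subst (ℚ._≤ p ℚ.+ q) (ℚP.+-identityʳ p) (ℚP.+-monoʳ-≤ p q≥0)

nonneg-+-≡0ˡ : ∀ {p q} → 0ℚ ℚ.≤ p → 0ℚ ℚ.≤ q → p ℚ.+ q ≡ 0ℚ → p ≡ 0ℚ
nonneg-+-≡0ˡ {p} p≥0 q≥0 p+q≡0 = ℚP.≤-antisym (subst (p ℚ.≤_) p+q≡0 (p≤p+q p q≥0)) p≥0

sumℚ-nonneg : ∀ {m} (w : Fin m → ℚ) → (∀ k → 0ℚ ℚ.≤ w k) → 0ℚ ℚ.≤ sumℚ w
sumℚ-nonneg {ℕ.zero}  w w≥0 = ℚP.≤-refl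
sumℚ-nonneg {ℕ.suc m} w w≥0 =
  ℚP.+-mono-≤ (w≥0 zero) (sumℚ-nonneg (λ k → w (suc k)) (λ k → w≥0 (suc k)))

weight≤sumℚ : ∀ {m} (w : Fin m → ℚ) → (∀ k → 0ℚ ℚ.≤ w k) → ∀ i → w i ℚ.≤ sumℚ w
weight≤sumℚ {ℕ.suc m} w w≥0 i =
  subst (w i ℚ.≤_) (sym (sumℚ-remove w i)) (p≤p+q (w i) (sumℚ-nonneg (removeAt w i) (λ k → w≥0 _)))

sumℚ-*-vanishes : ∀ {m} (w : Fin m → ℚ) → (∀ k → 0ℚ ℚ.≤ w k) → sumℚ w ≡ 0ℚ →
                  (f : Fin m → ℚ) → sumℚ (λ k → w k ℚ.* f k) ≡ 0ℚ
sumℚ-*-vanishes {ℕ.zero}  w w≥0 Σw≡0 f = refl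
sumℚ-*-vanishes {ℕ.suc m} w w≥0 Σw≡0 f = begin
  w zero ℚ.* f zero ℚ.+ sumℚ (λ k → w (suc k) ℚ.* f (suc k))
    ≡⟨ cong₂ ℚ._+_ (cong (ℚ._* f zero) w₀≡0) (sumℚ-*-vanishes _ (λ k → w≥0 (suc k)) rest≡0 _) ⟩
  0ℚ ℚ.* f zero ℚ.+ 0ℚ
    ≡⟨ cong (ℚ._+ 0ℚ) (ℚP.*-zeroˡ (f zero)) ⟩
  0ℚ ∎
  where
  open ≡-Reasoning
  rest = sumℚ (λ k → w (suc k))
  rest≥0 = sumℚ-nonneg _ (λ k → w≥0 (suc k))
  w₀≡0 : w zero ≡ 0ℚ
  w₀≡0 = nonneg-+-≡0ˡ (w≥0 zero) rest≥0 Σw≡0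
  rest≡0 : rest ≡ 0ℚ
  rest≡0 = nonneg-+-≡0ˡ rest≥0 (w≥0 zero) (trans (ℚP.+-comm rest (w zero)) Σw≡0)

sumℚ-*-concentrated : ∀ {m} (w : Fin m → ℚ) → (∀ k → 0ℚ ℚ.≤ w k) → ∀ i → sumℚ w ≡ w i →
                      (f : Fin m → ℚ) → sumℚ (λ k → w k ℚ.* f k) ≡ w i ℚ.* f i
sumℚ-*-concentrated {ℕ.suc m} w w≥0 i Σw≡wᵢ f = begin
  sumℚ (λ k → w k ℚ.* f k)                          ≡⟨ sumℚ-remove (λ k → w k ℚ.* f k) i ⟩
  w i ℚ.* f i ℚ.+ sumℚ (removeAt (λ k → w k ℚ.* f k) i)
    ≡⟨ cong (w i ℚ.* f i ℚ.+_) (sumℚ-*-vanishes (removeAt w i) (λ k → w≥0 _) rest≡0 (removeAt f i)) ⟩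
  w i ℚ.* f i ℚ.+ 0ℚ                                 ≡⟨ ℚP.+-identityʳ _ ⟩
  w i ℚ.* f i                                        ∎
  where
  open ≡-Reasoning
  rest≡0 : sumℚ (removeAt w i) ≡ 0ℚ
  rest≡0 = ℚ+.∙-cancelˡ (w i) _ 0ℚ (trans (sym (sumℚ-remove w i)) (trans Σw≡wᵢ (sym (ℚP.+-identityʳ (w i)))))

δ-sym : ∀ {m} (i j : Fin m) → δ i j ≡ δ j i
δ-sym zero    zero    = refl
δ-sym zero    (suc j) = refl
δ-sym (suc i) zero    = refl
δ-sym (suc i) (suc j) = δ-sym i j

δ-diag : ∀ {m} (i : Fin m) → δ i i ≡ + 1
δ-diag zero    = refl
δ-diag (suc i) = δ-diag i

δ-nonneg : ∀ {m} (i k : Fin m) → 0ℚ ℚ.≤ toℚ (δ i k)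
δ-nonneg zero    zero    = ℚP.≤ᵇ⇒≤ _
δ-nonneg zero    (suc k) = ℚP.≤-refl
δ-nonneg (suc i) zero    = ℚP.≤-refl
δ-nonneg (suc i) (suc k) = δ-nonneg i k

sumℚ-δ : ∀ {m} (i : Fin m) (f : Fin m → ℚ) → sumℚ (λ k → toℚ (δ i k) ℚ.* f k) ≡ f i
sumℚ-δ {ℕ.suc m} zero f = trans
  (cong₂ ℚ._+_ (ℚP.*-identityˡ (f zero)) (sumℚ-*-vanishes (λ _ → 0ℚ) (λ _ → ℚP.≤-refl) (sumℚ-zero m) (λ k → f (suc k))))
  (ℚP.+-identityʳ (f zero))
sumℚ-δ {ℕ.suc m} (suc i) f = trans
  (cong₂ ℚ._+_ (ℚP.*-zeroˡ (f zero)) (sumℚ-δ i (λ k → f (suc k))))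
  (ℚP.+-identityˡ (f (suc i)))

sumℤ-δ : ∀ {m} (i : Fin m) (x : Fin m → ℤ) → sumℤ (λ k → δ i k * x k) ≡ x i
sumℤ-δ i x = toℚ-injective (begin
  toℚ (sumℤ (λ k → δ i k * x k))              ≡⟨ toℚ-sum (λ k → δ i k * x k) ⟩
  sumℚ (λ k → toℚ (δ i k * x k))              ≡⟨ sumℚ-cong (λ k → toℚ-* (δ i k) (x k)) ⟩
  sumℚ (λ k → toℚ (δ i k) ℚ.* toℚ (x k))      ≡⟨ sumℚ-δ i (λ k → toℚ (x k)) ⟩
  toℚ (x i)                                   ∎)
  where open ≡-Reasoning

InConv-cong : ∀ {n m} {P : Fin m → Vecℤ n} {x y : Vecℚ n} → (∀ j → x j ≡ y j) → InConv P x → InConv P y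
InConv-cong x≗y (w , w≥0 , Σw≡1 , x≡) = w , w≥0 , Σw≡1 , λ j → trans (sym (x≗y j)) (x≡ j)

vertex∈InConv : ∀ {n m} (P : Fin m → Vecℤ n) i → InConv P (λ j → toℚ (P i j))
vertex∈InConv P i =
  (λ k → toℚ (δ i k)) , δ-nonneg i ,
  trans (sumℚ-cong (λ k → sym (ℚP.*-identityʳ (toℚ (δ i k))))) (sumℚ-δ i (λ _ → 1ℚ)) ,
  λ j → sym (sumℚ-δ i (λ k → toℚ (P k j)))

InConv-integer-unitCoordinate :
  ∀ {n m} (P : Fin m → Vecℤ n) (k₀ : Fin m) (i : Fin n) → (∀ k → P k i ≡ δ k₀ k) →
  (z : Vecℤ n) → InConv P (λ j → toℚ (z j)) → z i ≡ + 0 ⊎ (∀ j → z j ≡ P k₀ j)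
InConv-integer-unitCoordinate P k₀ i Pᵢ≡δ z (w , w≥0 , Σw≡1 , z≡) =
  decide (0≤i≤1⇒i≡0⊎i≡1 (toℚ-cancel-≤ (subst (0ℚ ℚ.≤_) (sym zᵢ≡w) (w≥0 k₀)))
                        (toℚ-cancel-≤ (subst₂ ℚ._≤_ (sym zᵢ≡w) Σw≡1 (weight≤sumℚ w w≥0 k₀))))
  where
  open ≡-Reasoning
  zᵢ≡w : toℚ (z i) ≡ w k₀
  zᵢ≡w = begin
    toℚ (z i)                          ≡⟨ z≡ i ⟩
    sumℚ (λ k → w k ℚ.* toℚ (P k i))   ≡⟨ sumℚ-cong (λ k → trans (cong (λ t → w k ℚ.* toℚ t) (Pᵢ≡δ k)) (ℚP.*-comm (w k) _)) ⟩
    sumℚ (λ k → toℚ (δ k₀ k) ℚ.* w k)  ≡⟨ sumℚ-δ k₀ w ⟩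
    w k₀                               ∎
  decide : z i ≡ + 0 ⊎ z i ≡ + 1 → z i ≡ + 0 ⊎ (∀ j → z j ≡ P k₀ j)
  decide (inj₁ zᵢ≡0) = inj₁ zᵢ≡0
  decide (inj₂ zᵢ≡1) = inj₂ λ j → toℚ-injective (begin
    toℚ (z j)                          ≡⟨ z≡ j ⟩
    sumℚ (λ k → w k ℚ.* toℚ (P k j))   ≡⟨ sumℚ-*-concentrated w w≥0 k₀ (trans Σw≡1 (sym w₀≡1)) _ ⟩
    w k₀ ℚ.* toℚ (P k₀ j)              ≡⟨ cong (ℚ._* toℚ (P k₀ j)) w₀≡1 ⟩
    1ℚ ℚ.* toℚ (P k₀ j)                ≡⟨ ℚP.*-identityˡ _ ⟩
    toℚ (P k₀ j)                       ∎)
    where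
    w₀≡1 : w k₀ ≡ 1ℚ
    w₀≡1 = trans (sym zᵢ≡w) (cong toℚ zᵢ≡1)

vertsQ-unitCoordinate : ∀ {m} (a b c d : ℤ) (j₀ : Fin m) k →
                        vertsQ a b c d k (suc (suc j₀)) ≡ δ (suc (suc (suc j₀))) k
vertsQ-unitCoordinate a b c d j₀ zero                = refl
vertsQ-unitCoordinate a b c d j₀ (suc zero)          = refl
vertsQ-unitCoordinate a b c d j₀ (suc (suc zero))    = refl
vertsQ-unitCoordinate a b c d j₀ (suc (suc (suc k))) = δ-sym k j₀

Q-integerPoint : ∀ {m} (a b c d : ℤ) (j₀ : Fin m) (z : Vecℤ (ℕ.suc (ℕ.suc m))) →
                 InConv (vertsQ a b c d) (λ j → toℚ (z j)) →
                 z (suc (suc j₀)) ≡ + 0 ⊎ (∀ j → z j ≡ e (suc (suc j₀)) j)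
Q-integerPoint a b c d j₀ =
  InConv-integer-unitCoordinate (vertsQ a b c d) (suc (suc (suc j₀))) (suc (suc j₀))
    (vertsQ-unitCoordinate a b c d j₀)

affℤ-toℚ : ∀ {n} (M : Matℤ n) (u v : Vecℤ n) j → affℚ M u (λ k → toℚ (v k)) j ≡ toℚ (affℤ M u v j)
affℤ-toℚ M u v j = sym (begin
  toℚ (sumℤ (λ k → M j k * v k) + u j)                 ≡⟨ toℚ-+ (sumℤ (λ k → M j k * v k)) (u j) ⟩
  toℚ (sumℤ (λ k → M j k * v k)) ℚ.+ toℚ (u j)         ≡⟨ cong (ℚ._+ toℚ (u j)) (toℚ-sum (λ k → M j k * v k)) ⟩
  sumℚ (λ k → toℚ (M j k * v k)) ℚ.+ toℚ (u j)         ≡⟨ cong (ℚ._+ toℚ (u j)) (sumℚ-cong (λ k → toℚ-* (M j k) (v k))) ⟩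
  sumℚ (λ k → toℚ (M j k) ℚ.* toℚ (v k)) ℚ.+ toℚ (u j) ∎)
  where open ≡-Reasoning

MapsOnto-vertex : ∀ {n m} (M : Matℤ n) (u : Vecℤ n) (P P′ : Fin m → Vecℤ n) →
                  MapsOnto M u P P′ → ∀ k → InConv P′ (λ j → toℚ (affℤ M u (P k) j))
MapsOnto-vertex M u P P′ onto k =
  InConv-cong {P = P′} (affℤ-toℚ M u (P k)) (proj₂ (onto (affℚ M u Pₖ)) Pₖ (vertex∈InConv P k) (λ _ → refl))
  where
  Pₖ : Vecℚ _
  Pₖ j = toℚ (P k j)

affℤ-zero : ∀ {n} (M : Matℤ n) (u : Vecℤ n) j → affℤ M u (λ _ → + 0) j ≡ u j
affℤ-zero M u j = trans (cong (_+ u j) (sumℤ-zero (λ k → ℤP.*-zeroʳ (M j k)))) (ℤP.+-identityˡ (u j))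

affℤ-emb2 : ∀ {m} (M : Matℤ (ℕ.suc (ℕ.suc m))) (u : Vecℤ (ℕ.suc (ℕ.suc m))) x y j →
            affℤ M u (emb2 x y) j ≡ M j zero * x + M j (suc zero) * y + u j
affℤ-emb2 M u x y j = cong (_+ u j) (begin
  M j zero * x + (M j (suc zero) * y + sumℤ (λ k → M j (suc (suc k)) * + 0))
    ≡⟨ cong (λ t → M j zero * x + (M j (suc zero) * y + t)) (sumℤ-zero (λ k → ℤP.*-zeroʳ (M j (suc (suc k))))) ⟩
  M j zero * x + (M j (suc zero) * y + + 0)
    ≡⟨ cong (_+_ (M j zero * x)) (ℤP.+-identityʳ _) ⟩
  M j zero * x + M j (suc zero) * y
    ∎)
  where open ≡-Reasoning

leftInverse-cancels : ∀ {n} {N M : Matℤ n} → (∀ i j → (N ·ₘ M) i j ≡ idMat i j) →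
                      ∀ (x : Vecℤ n) j → sumℤ (λ l → N j l * sumℤ (λ k → M l k * x k)) ≡ x j
leftInverse-cancels {N = N} {M} NM≡I x j = begin
  sumℤ (λ l → N j l * sumℤ (λ k → M l k * x k))      ≡⟨ sumℤ-cong (λ l → sumℤ-*ˡ (N j l) (λ k → M l k * x k)) ⟩
  sumℤ (λ l → sumℤ (λ k → N j l * (M l k * x k)))    ≡⟨ sumℤ-comm (λ l k → N j l * (M l k * x k)) ⟩
  sumℤ (λ k → sumℤ (λ l → N j l * (M l k * x k)))    ≡⟨ sumℤ-cong (λ k → sumℤ-cong (λ l → sym (ℤP.*-assoc (N j l) (M l k) (x k)))) ⟩
  sumℤ (λ k → sumℤ (λ l → N j l * M l k * x k))      ≡⟨ sumℤ-cong (λ k → sym (sumℤ-*ʳ (x k) (λ l → N j l * M l k))) ⟩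
  sumℤ (λ k → (N ·ₘ M) j k * x k)                    ≡⟨ sumℤ-cong (λ k → cong (_* x k) (NM≡I j k)) ⟩
  sumℤ (λ k → δ j k * x k)                           ≡⟨ sumℤ-δ j x ⟩
  x j                                                ∎
  where open ≡-Reasoning

affℤ-injective : ∀ {n} (M : Matℤ n) → GL n M → (u x y : Vecℤ n) →
                 (∀ j → affℤ M u x j ≡ affℤ M u y j) → ∀ j → x j ≡ y j
affℤ-injective M (N , _ , NM≡I) u x y Ux≡Uy j = begin
  x j                                             ≡⟨ sym (leftInverse-cancels {N = N} {M} NM≡I x j) ⟩
  sumℤ (λ l → N j l * sumℤ (λ k → M l k * x k))   ≡⟨ sumℤ-cong (λ l → cong (N j l *_) (Mx≡My l)) ⟩
  sumℤ (λ l → N j l * sumℤ (λ k → M l k * y k))   ≡⟨ leftInverse-cancels {N = N} {M} NM≡I y j ⟩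
  y j                                             ∎
  where
  open ≡-Reasoning
  Mx≡My : ∀ l → sumℤ (λ k → M l k * x k) ≡ sumℤ (λ k → M l k * y k)
  Mx≡My l = ℤ+.∙-cancelʳ (u l) _ _ (Ux≡Uy l)

GL₂-unitDet : ∀ a p b q E → E * (a * q - b * p) ≡ + 1 → GL 2 (mat2 a p b q)
GL₂-unitDet a p b q E E·det≡1 = adj , right , left
  where
  adj = mat2 (E * q) (- (E * p)) (- (E * b)) (E * a)
  r₀₀ : ∀ a p b q E → a * (E * q) + (p * - (E * b) + + 0) ≡ E * (a * q - b * p)
  r₀₀ = solve-∀
  r₀₁ : ∀ a p E → a * - (E * p) + (p * (E * a) + + 0) ≡ + 0
  r₀₁ = solve-∀
  r₁₀ : ∀ b q E → b * (E * q) + (q * - (E * b) + + 0) ≡ + 0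
  r₁₀ = solve-∀
  r₁₁ : ∀ a p b q E → b * - (E * p) + (q * (E * a) + + 0) ≡ E * (a * q - b * p)
  r₁₁ = solve-∀
  l₀₀ : ∀ a p b q E → E * q * a + (- (E * p) * b + + 0) ≡ E * (a * q - b * p)
  l₀₀ = solve-∀
  l₀₁ : ∀ p q E → E * q * p + (- (E * p) * q + + 0) ≡ + 0
  l₀₁ = solve-∀
  l₁₀ : ∀ a b E → - (E * b) * a + (E * a * b + + 0) ≡ + 0
  l₁₀ = solve-∀
  l₁₁ : ∀ a p b q E → - (E * b) * p + (E * a * q + + 0) ≡ E * (a * q - b * p)
  l₁₁ = solve-∀
  right : ∀ i j → (mat2 a p b q ·ₘ adj) i j ≡ idMat i j
  right zero       zero       = trans (r₀₀ a p b q E) E·det≡1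
  right zero       (suc zero) = r₀₁ a p E
  right (suc zero) zero       = r₁₀ b q E
  right (suc zero) (suc zero) = trans (r₁₁ a p b q E) E·det≡1
  left : ∀ i j → (adj ·ₘ mat2 a p b q) i j ≡ idMat i j
  left zero       zero       = trans (l₀₀ a p b q E) E·det≡1
  left zero       (suc zero) = l₀₁ p q E
  left (suc zero) zero       = l₁₀ a b E
  left (suc zero) (suc zero) = trans (l₁₁ a p b q E) E·det≡1

∣i∣≡1⇒i*i≡1 : ∀ {i} → ℤ.∣ i ∣ ≡ 1 → i * i ≡ + 1
∣i∣≡1⇒i*i≡1 {+ 1}      _ = refl
∣i∣≡1⇒i*i≡1 { -[1+ 0 ]} _ = refl

det≡0-of-zero-column : ∀ {a b} c d → a ≡ + 0 → b ≡ + 0 → a * d - b * c ≡ + 0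
det≡0-of-zero-column c d refl refl = vanish c d
  where
  vanish : ∀ c d → + 0 * d - + 0 * c ≡ + 0
  vanish = solve-∀

det≡0-of-equal-columns : ∀ a b {c d} → c ≡ a → d ≡ b → a * d - b * c ≡ + 0
det≡0-of-equal-columns a b refl refl = antisym a b
  where
  antisym : ∀ a b → a * b - b * a ≡ + 0
  antisym = solve-∀

det-divides-columns : ∀ a b c d x y → x * a + y * b ≡ + 1 → x * c + y * d ≡ + 0 →
                      (a * d - b * c) ℤS.∣ c × (a * d - b * c) ℤS.∣ d
det-divides-columns a b c d x y xa+yb≡1 xc+yd≡0 =
  ℤS.divides (- y) (sym (trans (column₁ a b c d x y) (ends c a))) ,
  ℤS.divides x (sym (trans (column₂ a b c d x y) (ends d b)))
  where
  column₁ : ∀ a b c d x y → - y * (a * d - b * c) ≡ c * (x * a + y * b) - a * (x * c + y * d)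
  column₁ = solve-∀
  column₂ : ∀ a b c d x y → x * (a * d - b * c) ≡ d * (x * a + y * b) - b * (x * c + y * d)
  column₂ = solve-∀
  unit : ∀ s t → s * + 1 - t * + 0 ≡ s
  unit = solve-∀
  ends : ∀ s t → s * (x * a + y * b) - t * (x * c + y * d) ≡ s
  ends s t = trans (cong₂ (λ α β → s * α - t * β) xa+yb≡1 xc+yd≡0) (unit s t)

columnQuotient-unimodular :
  ∀ a b c d x y → a * d - b * c ≢ 0ℤ → x * a + y * b ≡ + 1 → x * c + y * d ≡ + 0 →
  Σ ℤ λ p → Σ ℤ λ q → (c ≡ gcd c d * p) × (d ≡ gcd c d * q) × GL 2 (mat2 a p b q)
columnQuotient-unimodular a b c d x y det≢0 xa+yb≡1 xc+yd≡0 =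
  p , q , c≡gp , d≡gq , GL₂-unitDet a p b q D (∣i∣≡1⇒i*i≡1 {D} (ℕD.∣1⇒≡1 D∣1))
  where
  g = gcd c d
  g∣c : g ℤS.∣ c
  g∣c = ℤS.∣ᵤ⇒∣ (ℤG.gcd[i,j]∣i c d)
  g∣d : g ℤS.∣ d
  g∣d = ℤS.∣ᵤ⇒∣ (ℤG.gcd[i,j]∣j c d)
  p = ℤS._∣_.quotient g∣c
  q = ℤS._∣_.quotient g∣d
  c≡gp : c ≡ g * p
  c≡gp = trans (ℤS._∣_.equality g∣c) (ℤP.*-comm p g)
  d≡gq : d ≡ g * q
  d≡gq = trans (ℤS._∣_.equality g∣d) (ℤP.*-comm q g)
  D = a * q - b * p
  factor : ∀ a b g p q → a * (g * q) - b * (g * p) ≡ g * (a * q - b * p)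
  factor = solve-∀
  det≡gD : a * d - b * c ≡ g * D
  det≡gD = trans (cong₂ (λ s t → a * t - b * s) c≡gp d≡gq) (factor a b g p q)
  vanish : ∀ a b → a * + 0 - b * + 0 ≡ + 0
  vanish = solve-∀
  g≢0 : g ≢ 0ℤ
  g≢0 g≡0 = det≢0 (trans (cong₂ (λ s t → a * t - b * s) (ℤG.gcd[i,j]≡0⇒i≡0 c d g≡0) (ℤG.gcd[i,j]≡0⇒j≡0 {c} {d} g≡0))
                         (vanish a b))
  instance
    g-nonZero : ℤ.NonZero g
    g-nonZero = ℤ.≢-nonZero g≢0
  det∣g : (a * d - b * c) ℤU.∣ g
  det∣g = let det∣c , det∣d = det-divides-columns a b c d x y xa+yb≡1 xc+yd≡0 in
          ℤG.gcd-greatest {c} {d} {a * d - b * c} (ℤS.∣⇒∣ᵤ det∣c) (ℤS.∣⇒∣ᵤ det∣d)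
  D∣1 : D ℤU.∣ + 1
  D∣1 = ℤU.*-cancelˡ-∣ g {D} (subst₂ ℤU._∣_ det≡gD (sym (ℤP.*-identityʳ g)) det∣g)

lemma4p4 : (a b c d a′ b′ c′ d′ : ℤ) →
    a * d - b * c ≢ 0ℤ → a′ * d′ - b′ * c′ ≢ 0ℤ →
    (n : ℕ) → 2 < n →
    (M : Matℤ n) → GL n M → (u : Vecℤ n) →
    MapsOnto M u (vertsQ a b c d) (vertsQ a′ b′ c′ d′) →
    Σ (Fin n) (λ i → (2 ≤ toℕ i) × (∀ j → affℤ M u (emb2 a b) j ≡ e i j)) →
    Σ ℤ λ p → Σ ℤ λ q → (c ≡ gcd c d * p) × (d ≡ gcd c d * q) × GL 2 (mat2 a p b q)
lemma4p4 _ _ _ _ _ _ _ _ _ _ _ _ _ _ _ _ (zero , () , _)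
lemma4p4 _ _ _ _ _ _ _ _ _ _ _ _ _ _ _ _ (suc zero , ℕ.s≤s () , _)
-- Only the inclusion U(Q_{n,1}) ⊆ Q_{n,2} is used; Q_{n,2} need not be nondegenerate.
lemma4p4 a b c d a′ b′ c′ d′ det≢0 _ _ _ M M∈GL u onto (suc (suc j₀) , _ , U[a,b]≡eᵢ) =
  decide (Q-integerPoint a′ b′ c′ d′ j₀ U[0] (U[vertex]∈Q′ zero))
         (Q-integerPoint a′ b′ c′ d′ j₀ U[c,d] (U[vertex]∈Q′ (suc (suc zero))))
  where
  i = suc (suc j₀)
  U[0] = affℤ M u (λ _ → + 0)
  U[c,d] = affℤ M u (emb2 c d)
  U[vertex]∈Q′ = MapsOnto-vertex M u (vertsQ a b c d) (vertsQ a′ b′ c′ d′) onto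
  U-injective = affℤ-injective M M∈GL u
  Goal = Σ ℤ λ p → Σ ℤ λ q → (c ≡ gcd c d * p) × (d ≡ gcd c d * q) × GL 2 (mat2 a p b q)
  decide : U[0] i ≡ + 0 ⊎ (∀ j → U[0] j ≡ e i j) → U[c,d] i ≡ + 0 ⊎ (∀ j → U[c,d] j ≡ e i j) → Goal
  decide (inj₂ U[0]≡eᵢ) _ = ⊥-elim (det≢0 (det≡0-of-zero-column c d (a,b≡0 zero) (a,b≡0 (suc zero))))
    where a,b≡0 = U-injective (emb2 a b) (λ _ → + 0) (λ j → trans (U[a,b]≡eᵢ j) (sym (U[0]≡eᵢ j)))
  decide (inj₁ _) (inj₂ U[c,d]≡eᵢ) = ⊥-elim (det≢0 (det≡0-of-equal-columns a b (c,d≡a,b zero) (c,d≡a,b (suc zero))))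
    where c,d≡a,b = U-injective (emb2 c d) (emb2 a b) (λ j → trans (U[c,d]≡eᵢ j) (sym (U[a,b]≡eᵢ j)))
  decide (inj₁ U[0]ᵢ≡0) (inj₁ U[c,d]ᵢ≡0) =
    columnQuotient-unimodular a b c d (M i zero) (M i (suc zero)) det≢0
      (trans (rowᵢ a b) (trans (U[a,b]≡eᵢ i) (δ-diag i))) (trans (rowᵢ c d) U[c,d]ᵢ≡0)
    where
    rowᵢ : ∀ x y → M i zero * x + M i (suc zero) * y ≡ affℤ M u (emb2 x y) i
    rowᵢ x y = sym (trans (affℤ-emb2 M u x y i)
      (trans (cong (_+_ (M i zero * x + M i (suc zero) * y)) (trans (sym (affℤ-zero M u i)) U[0]ᵢ≡0)) (ℤP.+-identityʳ _)))
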